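{- Let $(X,\mathcal{L}=(B_1,\dots,B_b))$ be an $\mathrm{SCCD}(v,k,b)$ and let $(X',\mathcal{L}'=(B_1,\dots,B_b,B'_{b+1},\dots,B'_{b'}))$ be an $\mathrm{SCCD}(v',k,b')$ with $X\subseteq X'$. If $B'_i$ is a tight block of $(X',\mathcal{L}')$ for every $i$ with $b+1\le i\le b'$, then $(X',\mathcal{L}')$ has the same excess as $(X,\mathcal{L})$.
   Context: A (linear) single change covering design $\mathrm{SCCD}(v,k,b)$ is a $v$-set $X$ with an ordered list $(B_1,\dots,B_b)$ of $k$-subsets of $X$ with $|B_i\cap B_{i+1}|=k-1$ for $1\le i<b$, such that every pair of elements of $X$ is covered by some block. All elements of $B_1$ are introduced in $B_1$, and for $i\ge 2$ the element of $B_i\setminus B_{i-1}$ is introduced in $B_i$. A pair $S$ is covered in $B_i$ if $S\subseteq B_i$ and some element of $S$ is introduced in $B_i$. A block is tight if none of the pairs it covers is covered in any other block of the design. The excess of the design is $e=(k-1)b+\binom{k-1}{2}-\binom{v}{2}$. -}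

module Defs where

open import Data.Nat using (ℕ; zero; suc; _+_; _*_; _∸_; _≤_)
open import Data.Nat.Combinatorics using (_C_)
open import Data.Integer using (ℤ; +_; _-_)
open import Data.Fin using (Fin; toℕ)
open import Data.List using (List; length; filter)
open import Data.List.Membership.Propositional using (_∈_; _∉_)
open import Data.List.Membership.DecPropositional (Data.Nat._≟_) using (_∈?_)
open import Data.List.Relation.Unary.All using (All)
open import Data.List.Relation.Unary.Unique.Propositional using (Unique)
open import Data.Product using (Σ; _×_; ∃-syntax)
open import Data.Sum using (_⊎_)
open import Relation.Binary.PropositionalEquality using (_≡_; _≢_)
open import Relation.Nullary using (¬_)

-- Points are natural numbers; finite sets are duplicate-free lists of points.
-- A design with b blocks is a function  Fin b → List ℕ  (block i = B_{i+1}).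

∣_∩_∣ : List ℕ → List ℕ → ℕ
∣ B ∩ C ∣ = length (filter (λ x → x ∈? C) B)

record IsKSubset (X : List ℕ) (k : ℕ) (B : List ℕ) : Set where
  field
    unique : Unique B
    size   : length B ≡ k
    sub    : All (_∈ X) B

Introduced : {b : ℕ} → (Fin b → List ℕ) → Fin b → ℕ → Set
Introduced {b} B i x =
  (toℕ i ≡ 0 × x ∈ B i)
  ⊎ (∃[ j ] (toℕ i ≡ suc (toℕ j) × x ∈ B i × x ∉ B j))

CoveredIn : {b : ℕ} → (Fin b → List ℕ) → Fin b → ℕ → ℕ → Set
CoveredIn B i x y =
  x ≢ y × x ∈ B i × y ∈ B i × (Introduced B i x ⊎ Introduced B i y)

Tight : {b : ℕ} → (Fin b → List ℕ) → Fin b → Set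
Tight {b} B i =
  ∀ x y → CoveredIn B i x y → (j : Fin b) → j ≢ i → ¬ CoveredIn B j x y

record SCCD (v k b : ℕ) (X : List ℕ) (B : Fin b → List ℕ) : Set where
  field
    nonempty    : 1 ≤ b
    X-unique    : Unique X
    X-size      : length X ≡ v
    blocks      : (i : Fin b) → IsKSubset X k (B i)
    consecutive : (i j : Fin b) → toℕ j ≡ suc (toℕ i) → ∣ B i ∩ B j ∣ ≡ k ∸ 1
    covering    : ∀ x y → x ∈ X → y ∈ X → x ≢ y →
                  ∃[ i ] (x ∈ B i × y ∈ B i)

excess : ℕ → ℕ → ℕ → ℤ
excess v k b = + ((k ∸ 1) * b + (k ∸ 1) C 2) - + (v C 2)

-- Count ordered pairs of distinct points.  Each block B′ᵢ with i ≥ b shares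
-- k - 1 points with its predecessor, so it covers exactly 2(k - 1) ordered
-- pairs, and by tightness these pair sets are disjoint from each other and
-- from the pairs of X (which are already covered among the first b blocks).
-- Conversely, walking back from any block containing a pair to the last
-- block where one of its points is new shows that every pair of X′ not
-- inside X is covered in some block B′ᵢ with i ≥ b.  Hence
-- v′(v′ - 1) = v(v - 1) + 2(k - 1)(b′ - b), which is exactly the statement
-- that the excess does not change.
module Submission where

open import Defs
open import Data.Fin using (Fin; zero; suc; toℕ; inject₁; inject≤; _↑ˡ_; _↑ʳ_; splitAt)
open import Data.Fin.Properties
  using (toℕ-injective; toℕ-inject₁; toℕ-inject≤; toℕ-↑ˡ; toℕ-↑ʳ; ↑ʳ-injective; toℕ<n;
         splitAt⁻¹-↑ˡ; splitAt⁻¹-↑ʳ)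
open import Data.Integer using (+_; _-_; _⊖_)
open import Data.Integer.Properties using (m-n≡m⊖n; +-cancelˡ-⊖)
open import Data.List using (List; []; _∷_; length; map; filter; concatMap; allFin; _++_)
open import Data.List.Properties using (length-++; length-map; length-tabulate)
open import Data.List.Membership.Propositional using (_∈_; _∉_; find; lose)
open import Data.List.Membership.Propositional.Properties
  using (∈-filter⁺; ∈-filter⁻; ∈-map⁺; ∈-map⁻; ∈-++⁺ˡ; ∈-++⁺ʳ; ∈-++⁻;
         ∈-concatMap⁺; ∈-concatMap⁻; ∈-allFin)
open import Data.List.Membership.Propositional.Properties.WithK using (unique∧set⇒bag)
open import Data.List.Relation.Binary.BagAndSetEquality using (∼bag⇒↭)
open import Data.List.Relation.Binary.Disjoint.Propositional using (Disjoint)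
open import Data.List.Relation.Binary.Permutation.Propositional.Properties using (↭-length)
open import Data.List.Relation.Binary.Subset.Propositional using (_⊆_)
open import Data.List.Relation.Unary.All as All using (All)
open import Data.List.Relation.Unary.AllPairs using ([]; _∷_)
open import Data.List.Relation.Unary.Any using (here; there)
open import Data.List.Relation.Unary.Unique.Propositional using (Unique)
open import Data.List.Relation.Unary.Unique.Propositional.Properties using (++⁺; map⁺; filter⁺; allFin⁺)
open import Data.Nat as ℕ using (ℕ; zero; suc; _+_; _*_; _∸_; _≤_; _<_; z≤n)
open import Data.List.Membership.DecPropositional ℕ._≟_ using (_∈?_)
open import Data.Nat.Combinatorics using (_C_; nC1≡n; nCk+nC[k+1]≡[n+1]C[k+1])
open import Data.Nat.Properties
  using (≤-refl; ≤-trans; ≤-reflexive; ≤-<-trans; <⇒≱; m≤m+n; m≤n⇒m≤1+n;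
         suc-injective; +-comm; +-cancelˡ-≡; *-cancelˡ-≡; *-distribˡ-+; m≤n⇒∃[o]m+o≡n)
open import Data.Nat.Tactic.RingSolver using (solve-∀)
open import Data.Product using (_×_; _,_; ∃-syntax; proj₁; proj₂)
open import Data.Sum as Sum using (_⊎_; inj₁; inj₂; [_,_]′)
open import Function using (_∘_; mk⇔)
open import Relation.Binary.Definitions using (DecidableEquality)
open import Relation.Binary.PropositionalEquality
  using (_≡_; _≢_; refl; sym; trans; cong; cong₂; subst; module ≡-Reasoning)
open import Relation.Nullary using (yes; no; ¬?)
open import Relation.Nullary.Decidable using (_⊎-dec_)
open import Relation.Unary using (Decidable)

open ≡-Reasoning

module _ {A : Set} where

  unique∧⊆∧⊇⇒length≡ : {xs ys : List A} → Unique xs → Unique ys →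
                        xs ⊆ ys → ys ⊆ xs → length xs ≡ length ys
  unique∧⊆∧⊇⇒length≡ xs! ys! xs⊆ys ys⊆xs =
    ↭-length (∼bag⇒↭ (unique∧set⇒bag xs! ys! (mk⇔ xs⊆ys ys⊆xs)))

  length-disjoint-union : {zs xs ys : List A} → Unique zs → Unique xs → Unique ys →
                          Disjoint xs ys → zs ⊆ xs ++ ys → xs ++ ys ⊆ zs →
                          length zs ≡ length xs + length ys
  length-disjoint-union {xs = xs} zs! xs! ys! disjoint split merge =
    trans (unique∧⊆∧⊇⇒length≡ zs! (++⁺ xs! ys! disjoint) split merge) (length-++ xs)

  module _ {B : Set} (f : A → List B) where

    length-concatMap-const : ∀ {c} xs → (∀ {x} → x ∈ xs → length (f x) ≡ c) →
                             length (concatMap f xs) ≡ length xs * c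
    length-concatMap-const []       _   = refl
    length-concatMap-const (x ∷ xs) len = begin
      length (f x ++ concatMap f xs)          ≡⟨ length-++ (f x) ⟩
      length (f x) + length (concatMap f xs)  ≡⟨ cong₂ _+_ (len (here refl))
                                                   (length-concatMap-const xs (len ∘ there)) ⟩
      _                                       ∎

    concatMap-unique : ∀ {xs} → Unique xs → (∀ x → Unique (f x)) →
                       (∀ {x y} → x ≢ y → Disjoint (f x) (f y)) →
                       Unique (concatMap f xs)
    concatMap-unique []            _  _        = []
    concatMap-unique (x∉xs ∷ xs!) f! disjoint =
      ++⁺ (f! _) (concatMap-unique xs! f! disjoint) λ (c∈fx , c∈rest) →
        let y , y∈xs , c∈fy = find (∈-concatMap⁻ f c∈rest)
        in disjoint (All.lookup x∉xs y∈xs) (c∈fx , c∈fy)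

module DistinctPairs {A : Set} (_≟_ : DecidableEquality A) where

  delete : A → List A → List A
  delete x = filter (λ y → ¬? (x ≟ y))

  ∈-delete⁺ : ∀ {x y xs} → y ∈ xs → x ≢ y → y ∈ delete x xs
  ∈-delete⁺ = ∈-filter⁺ _

  ∈-delete⁻ : ∀ {x y xs} → y ∈ delete x xs → y ∈ xs × x ≢ y
  ∈-delete⁻ = ∈-filter⁻ _

  delete-unique : ∀ {x xs} → Unique xs → Unique (delete x xs)
  delete-unique = filter⁺ _

  length-delete : ∀ {x xs} → Unique xs → x ∈ xs → suc (length (delete x xs)) ≡ length xs
  length-delete {x} {xs} xs! x∈xs =
    unique∧⊆∧⊇⇒length≡ (All.tabulate (proj₂ ∘ ∈-delete⁻ {xs = xs}) ∷ delete-unique xs!) xs!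
                        x∷delete⊆xs xs⊆x∷delete
    where
    x∷delete⊆xs : x ∷ delete x xs ⊆ xs
    x∷delete⊆xs (here refl) = x∈xs
    x∷delete⊆xs (there y∈)  = proj₁ (∈-delete⁻ y∈)
    xs⊆x∷delete : xs ⊆ x ∷ delete x xs
    xs⊆x∷delete {y} y∈xs with x ≟ y
    ... | yes refl = here refl
    ... | no x≢y   = there (∈-delete⁺ y∈xs x≢y)

  offDiagonal : List A → List (A × A)
  offDiagonal xs = concatMap (λ x → map (x ,_) (delete x xs)) xs

  ∈-offDiagonal⁺ : ∀ {x y xs} → x ∈ xs → y ∈ xs → x ≢ y → (x , y) ∈ offDiagonal xs
  ∈-offDiagonal⁺ {x} {xs = xs} x∈xs y∈xs x≢y =
    ∈-concatMap⁺ (λ x → map (x ,_) (delete x xs)) (lose x∈xs (∈-map⁺ (x ,_) (∈-delete⁺ y∈xs x≢y)))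

  ∈-offDiagonal⁻ : ∀ {x y xs} → (x , y) ∈ offDiagonal xs → x ∈ xs × y ∈ xs × x ≢ y
  ∈-offDiagonal⁻ {xs = xs} p with find (∈-concatMap⁻ (λ x → map (x ,_) (delete x xs)) p)
  ... | x , x∈xs , q with ∈-map⁻ (x ,_) q
  ...   | y , y∈ , refl = let y∈xs , x≢y = ∈-delete⁻ y∈ in x∈xs , y∈xs , x≢y

  offDiagonal-mono : ∀ {xs ys} → xs ⊆ ys → offDiagonal xs ⊆ offDiagonal ys
  offDiagonal-mono xs⊆ys {_ , _} p =
    let x∈ , y∈ , x≢y = ∈-offDiagonal⁻ p in ∈-offDiagonal⁺ (xs⊆ys x∈) (xs⊆ys y∈) x≢y

  offDiagonal-unique : ∀ {xs} → Unique xs → Unique (offDiagonal xs)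
  offDiagonal-unique {xs} xs! =
    concatMap-unique _ xs! (λ _ → map⁺ (cong proj₂) (delete-unique xs!)) disjoint
    where
    disjoint : ∀ {x x′} → x ≢ x′ → Disjoint (map (x ,_) (delete x xs)) (map (x′ ,_) (delete x′ xs))
    disjoint x≢x′ (p , p′) with ∈-map⁻ _ p | ∈-map⁻ _ p′
    ... | _ , _ , refl | _ , _ , e = x≢x′ (cong proj₁ e)

  length-offDiagonal : ∀ {xs} → Unique xs → length (offDiagonal xs) ≡ length xs * (length xs ∸ 1)
  length-offDiagonal {xs} xs! = length-concatMap-const _ xs λ {x} x∈xs →
    trans (length-map (x ,_) (delete x xs)) (cong (_∸ 1) (length-delete xs! x∈xs))

n[n∸1]≡[n∸1][n∸2]+2[n∸1] : ∀ n → n * (n ∸ 1) ≡ (n ∸ 1) * (n ∸ 1 ∸ 1) + 2 * (n ∸ 1)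
n[n∸1]≡[n∸1][n∸2]+2[n∸1] zero          = refl
n[n∸1]≡[n∸1][n∸2]+2[n∸1] (suc zero)    = refl
n[n∸1]≡[n∸1][n∸2]+2[n∸1] (suc (suc n)) = identity n
  where
  identity : ∀ n → (2 + n) * (1 + n) ≡ (1 + n) * n + 2 * (1 + n)
  identity = solve-∀

2*nC2≡n[n∸1] : ∀ n → 2 * (n C 2) ≡ n * (n ∸ 1)
2*nC2≡n[n∸1] zero    = refl
2*nC2≡n[n∸1] (suc n) = begin
  2 * (suc n C 2)           ≡⟨ cong (2 *_) (nCk+nC[k+1]≡[n+1]C[k+1] n 1) ⟨
  2 * (n C 1 + n C 2)       ≡⟨ cong (λ c → 2 * (c + n C 2)) (nC1≡n n) ⟩
  2 * (n + n C 2)           ≡⟨ *-distribˡ-+ 2 n (n C 2) ⟩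
  2 * n + 2 * (n C 2)       ≡⟨ cong (λ c → 2 * n + c) (2*nC2≡n[n∸1] n) ⟩
  2 * n + n * (n ∸ 1)       ≡⟨ +-comm (2 * n) _ ⟩
  n * (n ∸ 1) + 2 * n       ≡⟨ n[n∸1]≡[n∸1][n∸2]+2[n∸1] (suc n) ⟨
  suc n * n                 ∎

open DistinctPairs ℕ._≟_

NotBothIn : List ℕ → ℕ × ℕ → Set
NotBothIn P (x , y) = x ∉ P ⊎ y ∉ P

notBothIn? : ∀ P → Decidable (NotBothIn P)
notBothIn? P (x , y) = ¬? (x ∈? P) ⊎-dec ¬? (y ∈? P)

newPairs : List ℕ → List ℕ → List (ℕ × ℕ)
newPairs P C = filter (notBothIn? P) (offDiagonal C)

newPairs-unique : ∀ {P C} → Unique C → Unique (newPairs P C)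
newPairs-unique C! = filter⁺ _ (offDiagonal-unique C!)

offDiagonal-length-split : ∀ {P C} → Unique P → Unique C →
                           length (offDiagonal C) ≡ length (offDiagonal (filter (_∈? C) P)) + length (newPairs P C)
offDiagonal-length-split {P} {C} P! C! =
  length-disjoint-union (offDiagonal-unique C!) (offDiagonal-unique (filter⁺ _ P!)) (newPairs-unique C!)
                        disjoint split merge
  where
  P∩C = filter (_∈? C) P
  P∩C⊆C : P∩C ⊆ C
  P∩C⊆C = proj₂ ∘ ∈-filter⁻ (_∈? C) {xs = P}
  P∩C⊆P : P∩C ⊆ P
  P∩C⊆P = proj₁ ∘ ∈-filter⁻ (_∈? C) {xs = P}
  disjoint : Disjoint (offDiagonal P∩C) (newPairs P C)
  disjoint {x , y} (p , q) with ∈-offDiagonal⁻ p | proj₂ (∈-filter⁻ (notBothIn? P) {xs = offDiagonal C} q)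
  ... | x∈ , _ , _ | inj₁ x∉P = x∉P (P∩C⊆P x∈)
  ... | _ , y∈ , _ | inj₂ y∉P = y∉P (P∩C⊆P y∈)
  split : offDiagonal C ⊆ offDiagonal P∩C ++ newPairs P C
  split {x , y} p with x ∈? P | y ∈? P
  ... | yes x∈P | yes y∈P = let x∈C , y∈C , x≢y = ∈-offDiagonal⁻ p in
    ∈-++⁺ˡ (∈-offDiagonal⁺ (∈-filter⁺ (_∈? C) x∈P x∈C) (∈-filter⁺ (_∈? C) y∈P y∈C) x≢y)
  ... | no x∉P  | _       = ∈-++⁺ʳ _ (∈-filter⁺ (notBothIn? P) p (inj₁ x∉P))
  ... | yes _   | no y∉P  = ∈-++⁺ʳ _ (∈-filter⁺ (notBothIn? P) p (inj₂ y∉P))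
  merge : offDiagonal P∩C ++ newPairs P C ⊆ offDiagonal C
  merge = [ offDiagonal-mono P∩C⊆C , proj₁ ∘ ∈-filter⁻ (notBothIn? P) {xs = offDiagonal C} ]′
        ∘ ∈-++⁻ _

length-newPairs : ∀ {k P C} → Unique P → Unique C → length C ≡ k → ∣ P ∩ C ∣ ≡ k ∸ 1 →
                  length (newPairs P C) ≡ 2 * (k ∸ 1)
length-newPairs {P = P} {C} P! C! refl ∣P∩C∣≡k∸1 = +-cancelˡ-≡ (m * (m ∸ 1)) _ _ (begin
  m * (m ∸ 1) + length (newPairs P C)
    ≡⟨ cong (λ i → i * (i ∸ 1) + length (newPairs P C)) ∣P∩C∣≡k∸1 ⟨
  ∣ P ∩ C ∣ * (∣ P ∩ C ∣ ∸ 1) + length (newPairs P C)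
    ≡⟨ cong (_+ length (newPairs P C)) (length-offDiagonal (filter⁺ _ P!)) ⟨
  length (offDiagonal (filter (_∈? C) P)) + length (newPairs P C)
    ≡⟨ offDiagonal-length-split P! C! ⟨
  length (offDiagonal C)
    ≡⟨ length-offDiagonal C! ⟩
  length C * (length C ∸ 1)
    ≡⟨ n[n∸1]≡[n∸1][n∸2]+2[n∸1] (length C) ⟩
  m * (m ∸ 1) + 2 * m
    ∎)
  where
  m = length C ∸ 1

introduced-suc⁺ : ∀ {n} {B : Fin (suc n) → List ℕ} {j x} →
                  x ∈ B (suc j) → x ∉ B (inject₁ j) → Introduced B (suc j) x
introduced-suc⁺ {j = j} x∈ x∉ = inj₂ (inject₁ j , cong suc (sym (toℕ-inject₁ j)) , x∈ , x∉)

introduced-suc⁻ : ∀ {n} {B : Fin (suc n) → List ℕ} {j x} →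
                  Introduced B (suc j) x → x ∉ B (inject₁ j)
introduced-suc⁻ (inj₁ (() , _))
introduced-suc⁻ {B = B} {j} {x} (inj₂ (j′ , 1+j≡1+j′ , _ , x∉)) =
  subst (λ i → x ∉ B i) (toℕ-injective (trans (sym (suc-injective 1+j≡1+j′)) (sym (toℕ-inject₁ j)))) x∉

∈-newPairs⁺ : ∀ {n} {B : Fin (suc n) → List ℕ} {j x y} →
              CoveredIn B (suc j) x y → (x , y) ∈ newPairs (B (inject₁ j)) (B (suc j))
∈-newPairs⁺ (x≢y , x∈ , y∈ , intro) =
  ∈-filter⁺ (notBothIn? _) (∈-offDiagonal⁺ x∈ y∈ x≢y) (Sum.map introduced-suc⁻ introduced-suc⁻ intro)

∈-newPairs⁻ : ∀ {n} {B : Fin (suc n) → List ℕ} {j x y} →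
              (x , y) ∈ newPairs (B (inject₁ j)) (B (suc j)) → CoveredIn B (suc j) x y
∈-newPairs⁻ p =
  let p∈C , notBoth    = ∈-filter⁻ (notBothIn? _) p
      x∈ , y∈ , x≢y = ∈-offDiagonal⁻ p∈C
  in x≢y , x∈ , y∈ , Sum.map (introduced-suc⁺ x∈) (introduced-suc⁺ y∈) notBoth

introduced-inject₁ : ∀ {n} {B : Fin (suc n) → List ℕ} {i x} →
                     Introduced (B ∘ inject₁) i x → Introduced B (inject₁ i) x
introduced-inject₁ {i = i} (inj₁ (i≡0 , x∈)) = inj₁ (trans (toℕ-inject₁ i) i≡0 , x∈)
introduced-inject₁ {i = i} (inj₂ (j , i≡1+j , x∈ , x∉)) =
  inj₂ (inject₁ j , trans (toℕ-inject₁ i) (trans i≡1+j (cong suc (sym (toℕ-inject₁ j)))) , x∈ , x∉)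

coveredIn-inject₁ : ∀ {n} {B : Fin (suc n) → List ℕ} {i x y} →
                    CoveredIn (B ∘ inject₁) i x y → CoveredIn B (inject₁ i) x y
coveredIn-inject₁ (x≢y , x∈ , y∈ , intro) =
  x≢y , x∈ , y∈ , Sum.map introduced-inject₁ introduced-inject₁ intro

coveredIn-at-or-before : ∀ {n} (B : Fin n → List ℕ) (i : Fin n) {x y} →
                         x ≢ y → x ∈ B i → y ∈ B i → ∃[ h ] (toℕ h ≤ toℕ i × CoveredIn B h x y)
coveredIn-at-or-before B zero x≢y x∈ y∈ = zero , z≤n , x≢y , x∈ , y∈ , inj₁ (inj₁ (refl , x∈))
coveredIn-at-or-before B (suc j) {x} {y} x≢y x∈ y∈ with x ∈? B (inject₁ j) | y ∈? B (inject₁ j)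
... | yes x∈′ | yes y∈′ =
  let h , h≤j , covered = coveredIn-at-or-before (B ∘ inject₁) j x≢y x∈′ y∈′
  in inject₁ h , ≤-trans (≤-reflexive (toℕ-inject₁ h)) (m≤n⇒m≤1+n h≤j) , coveredIn-inject₁ covered
... | no x∉  | _       = suc j , ≤-refl , x≢y , x∈ , y∈ , inj₁ (introduced-suc⁺ x∈ x∉)
... | yes _  | no y∉   = suc j , ≤-refl , x≢y , x∈ , y∈ , inj₂ (introduced-suc⁺ y∈ y∉)

m≤toℕ[m↑ʳi] : ∀ m {n} (i : Fin n) → m ≤ toℕ (m ↑ʳ i)
m≤toℕ[m↑ʳi] m i = subst (m ≤_) (sym (toℕ-↑ʳ m i)) (m≤m+n m (toℕ i))

module TightExtension
  {v k b₀ d v′ : ℕ} {X X′ : List ℕ}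
  {B : Fin (suc b₀) → List ℕ} {B′ : Fin (suc b₀ + d) → List ℕ}
  (S : SCCD v k (suc b₀) X B) (S′ : SCCD v′ k (suc b₀ + d) X′ B′)
  (old-blocks : ∀ i → B′ (i ↑ˡ d) ≡ B i)
  (X⊆X′ : X ⊆ X′)
  (new-tight : ∀ t → Tight B′ (suc b₀ ↑ʳ t))
  where

  private
    module S  = SCCD S
    module S′ = SCCD S′

  block⊆X : ∀ i → B i ⊆ X
  block⊆X i = All.lookup (IsKSubset.sub (S.blocks i))

  old-block⊆X : ∀ j → B′ (j ↑ˡ d) ⊆ X
  old-block⊆X j = block⊆X j ∘ subst (_ ∈_) (old-blocks j)

  block′⊆X′ : ∀ i → B′ i ⊆ X′
  block′⊆X′ i = All.lookup (IsKSubset.sub (S′.blocks i))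

  -- Block b + t is suc (b₀ ↑ʳ t), definitionally suc b₀ ↑ʳ t; its predecessor is inject₁ (b₀ ↑ʳ t).
  newPairsAt : Fin d → List (ℕ × ℕ)
  newPairsAt t = newPairs (B′ (inject₁ (b₀ ↑ʳ t))) (B′ (suc (b₀ ↑ʳ t)))

  newBlockPairs : List (ℕ × ℕ)
  newBlockPairs = concatMap newPairsAt (allFin d)

  ∈-newBlockPairs⁻ : ∀ {x y} → (x , y) ∈ newBlockPairs → ∃[ t ] CoveredIn B′ (suc b₀ ↑ʳ t) x y
  ∈-newBlockPairs⁻ p = let t , _ , q = find (∈-concatMap⁻ newPairsAt {xs = allFin d} p) in t , ∈-newPairs⁻ q

  length-newPairsAt : ∀ t → length (newPairsAt t) ≡ 2 * (k ∸ 1)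
  length-newPairsAt t =
    length-newPairs (IsKSubset.unique (S′.blocks _)) (IsKSubset.unique (S′.blocks _))
                    (IsKSubset.size (S′.blocks _))
                    (S′.consecutive _ _ (cong suc (sym (toℕ-inject₁ (b₀ ↑ʳ t)))))

  newBlockPairs-unique : Unique newBlockPairs
  newBlockPairs-unique = concatMap-unique newPairsAt (allFin⁺ d)
    (λ _ → newPairs-unique (IsKSubset.unique (S′.blocks _))) disjoint
    where
    disjoint : ∀ {t t′} → t ≢ t′ → Disjoint (newPairsAt t) (newPairsAt t′)
    disjoint {t} {t′} t≢t′ {x , y} (p , p′) =
      new-tight t x y (∈-newPairs⁻ p) (suc b₀ ↑ʳ t′)
        (λ e → t≢t′ (sym (↑ʳ-injective (suc b₀) t′ t e))) (∈-newPairs⁻ p′)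

  length-newBlockPairs : length newBlockPairs ≡ d * (2 * (k ∸ 1))
  length-newBlockPairs = trans (length-concatMap-const newPairsAt (allFin d) (λ _ → length-newPairsAt _))
                   (cong (_* (2 * (k ∸ 1))) (length-tabulate {n = d} (λ i → i)))

  covered-old-or-new : ∀ {i x y} → CoveredIn B′ i x y → (x ∈ X × y ∈ X) ⊎ (x , y) ∈ newBlockPairs
  covered-old-or-new {i} {x} {y} covered with splitAt (suc b₀) i in eq
  ... | inj₁ j =
    let _ , x∈ , y∈ , _ = subst (λ i → CoveredIn B′ i x y) (sym (splitAt⁻¹-↑ˡ eq)) covered
    in inj₁ (old-block⊆X j x∈ , old-block⊆X j y∈)
  ... | inj₂ t = inj₂ (∈-concatMap⁺ newPairsAt (lose (∈-allFin t)
                   (∈-newPairs⁺ (subst (λ i → CoveredIn B′ i x y) (sym (splitAt⁻¹-↑ʳ eq)) covered))))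

  covered-early : ∀ {x y} → x ∈ X → y ∈ X → x ≢ y → ∃[ i ] (toℕ i < suc b₀ × CoveredIn B′ i x y)
  covered-early {x} {y} x∈ y∈ x≢y =
    let j , x∈Bj , y∈Bj = S.covering x y x∈ y∈ x≢y
        i , i≤j , covered = coveredIn-at-or-before B′ (j ↑ˡ d) x≢y
                              (subst (x ∈_) (sym (old-blocks j)) x∈Bj) (subst (y ∈_) (sym (old-blocks j)) y∈Bj)
    in i , ≤-<-trans i≤j (subst (_< suc b₀) (sym (toℕ-↑ˡ j d)) (toℕ<n j)) , covered

  old-new-disjoint : Disjoint (offDiagonal X) newBlockPairs
  old-new-disjoint {x , y} (p , q) =
    let x∈ , y∈ , x≢y = ∈-offDiagonal⁻ p
        i , i<b , covered = covered-early x∈ y∈ x≢y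
        t , covered′ = ∈-newBlockPairs⁻ q
    in new-tight t x y covered′ i
         (λ e → <⇒≱ i<b (subst (λ j → suc b₀ ≤ toℕ j) (sym e) (m≤toℕ[m↑ʳi] (suc b₀) t))) covered

  split : offDiagonal X′ ⊆ offDiagonal X ++ newBlockPairs
  split {x , y} p =
    let x∈ , y∈ , x≢y = ∈-offDiagonal⁻ p
        j , x∈Bj , y∈Bj = S′.covering x y x∈ y∈ x≢y
        _ , _ , covered = coveredIn-at-or-before B′ j x≢y x∈Bj y∈Bj
    in [ (λ (x∈X , y∈X) → ∈-++⁺ˡ (∈-offDiagonal⁺ x∈X y∈X x≢y)) , ∈-++⁺ʳ _ ]′
         (covered-old-or-new covered)

  merge : offDiagonal X ++ newBlockPairs ⊆ offDiagonal X′
  merge = [ offDiagonal-mono X⊆X′ , newBlockPairs⊆ ]′ ∘ ∈-++⁻ _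
    where
    newBlockPairs⊆ : newBlockPairs ⊆ offDiagonal X′
    newBlockPairs⊆ {x , y} p =
      let t , x≢y , x∈ , y∈ , _ = ∈-newBlockPairs⁻ p
      in ∈-offDiagonal⁺ (block′⊆X′ _ x∈) (block′⊆X′ _ y∈) x≢y

  pair-count : v′ * (v′ ∸ 1) ≡ v * (v ∸ 1) + d * (2 * (k ∸ 1))
  pair-count = begin
    v′ * (v′ ∸ 1)                        ≡⟨ cong (λ n → n * (n ∸ 1)) S′.X-size ⟨
    length X′ * (length X′ ∸ 1)          ≡⟨ length-offDiagonal S′.X-unique ⟨
    length (offDiagonal X′)              ≡⟨ length-disjoint-union (offDiagonal-unique S′.X-unique)
                                              (offDiagonal-unique S.X-unique) newBlockPairs-unique
                                              old-new-disjoint split merge ⟩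
    length (offDiagonal X) + length newBlockPairs
                                         ≡⟨ cong₂ _+_ (length-offDiagonal S.X-unique) length-newBlockPairs ⟩
    length X * (length X ∸ 1) + d * (2 * (k ∸ 1))
                                         ≡⟨ cong (λ n → n * (n ∸ 1) + d * (2 * (k ∸ 1))) S.X-size ⟩
    v * (v ∸ 1) + d * (2 * (k ∸ 1))      ∎

excess-extension : ∀ v v′ k b d → v′ * (v′ ∸ 1) ≡ v * (v ∸ 1) + d * (2 * (k ∸ 1)) →
                   excess v′ k (b + d) ≡ excess v k b
excess-extension v v′ k b d pair-count = begin
  + ((k ∸ 1) * (b + d) + (k ∸ 1) C 2) - + (v′ C 2) ≡⟨ cong₂ (λ a s → + a - + s) blocks points ⟩
  + (t + a) - + (t + s)                            ≡⟨ m-n≡m⊖n (t + a) (t + s) ⟩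
  (t + a) ⊖ (t + s)                                ≡⟨ +-cancelˡ-⊖ t a s ⟩
  a ⊖ s                                            ≡⟨ m-n≡m⊖n a s ⟨
  + a - + s                                        ∎
  where
  t = d * (k ∸ 1)
  a = (k ∸ 1) * b + (k ∸ 1) C 2
  s = v C 2
  blocks : (k ∸ 1) * (b + d) + (k ∸ 1) C 2 ≡ t + a
  blocks = identity (k ∸ 1) b d ((k ∸ 1) C 2)
    where
    identity : ∀ K b d c → K * (b + d) + c ≡ d * K + (K * b + c)
    identity = solve-∀
  points : v′ C 2 ≡ t + s
  points = *-cancelˡ-≡ _ _ 2 (begin
    2 * (v′ C 2)                 ≡⟨ 2*nC2≡n[n∸1] v′ ⟩
    v′ * (v′ ∸ 1)                ≡⟨ pair-count ⟩
    v * (v ∸ 1) + d * (2 * (k ∸ 1)) ≡⟨ cong (_+ d * (2 * (k ∸ 1))) (2*nC2≡n[n∸1] v) ⟨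
    2 * s + d * (2 * (k ∸ 1))    ≡⟨ identity s d (k ∸ 1) ⟩
    2 * (t + s)                  ∎)
    where
    identity : ∀ c d K → 2 * c + d * (2 * K) ≡ 2 * (d * K + c)
    identity = solve-∀

lemma4 : (v k b v′ b′ : ℕ) (X X′ : List ℕ)
         (B : Fin b → List ℕ) (B′ : Fin b′ → List ℕ) →
         SCCD v k b X B →
         SCCD v′ k b′ X′ B′ →
         (b≤b′ : b ≤ b′) →
         ((i : Fin b) → B′ (inject≤ i b≤b′) ≡ B i) →
         (∀ x → x ∈ X → x ∈ X′) →
         ((i : Fin b′) → b ≤ toℕ i → Tight B′ i) →
         excess v′ k b′ ≡ excess v k b
lemma4 v k zero v′ b′ X X′ B B′ S S′ b≤b′ agree X⊆X′ tight with () ← SCCD.nonempty S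
lemma4 v k (suc b₀) v′ b′ X X′ B B′ S S′ b≤b′ agree X⊆X′ tight with m≤n⇒∃[o]m+o≡n b≤b′
... | d , refl =
  excess-extension v v′ k (suc b₀) d (TightExtension.pair-count S S′ old-blocks (X⊆X′ _) new-tight)
  where
  old-blocks : ∀ i → B′ (i ↑ˡ d) ≡ B i
  old-blocks i =
    trans (cong B′ (toℕ-injective (trans (toℕ-↑ˡ i d) (sym (toℕ-inject≤ i b≤b′))))) (agree i)
  new-tight : ∀ t → Tight B′ (suc b₀ ↑ʳ t)
  new-tight t = tight (suc b₀ ↑ʳ t) (m≤toℕ[m↑ʳi] (suc b₀) t)
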